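{- Let $\tau$ be the translation from RoCTL*$_{\mathbf v}$ formulas to QCTL* formulas defined recursively by: - $\tau(p)=p$; - $\tau(\neg\phi)=\neg\tau(\phi)$; - $\tau(\phi\wedge\psi)=\tau(\phi)\wedge\tau(\psi)$; - $\tau(\phi U\psi)=\tau(\phi)U\tau(\psi)$; - $\tau(N\phi)=N\tau(\phi)$; - $\tau(A\phi)=A\tau(\phi)$; - $\tau(O\phi)=A(NG\neg\mathbf v\rightarrow\tau(\phi))$; - $\tau(\blacktriangle\phi)=\neg\,\forall y\,[Gy\rightarrow E[(Gy\vee F(y\wedge NNG\neg\mathbf v))\wedge\neg\tau(\phi)]]$, where $y$ is a fresh atom. Then every RoCTL*$_{\mathbf v}$ formula $\phi$ is satisfiable in RoCTL*$_{\mathbf v}$ (true on some fullpath of some RoCTL-structure) if and only if $AGEN\neg\mathbf v\wedge\tau(\phi)$ is satisfiable in the tree semantics of QCTL* (true on some fullpath of some tree structure).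
   Context: Fix a set $\mathcal V$ of atoms containing a distinguished atom $\mathbf v$. A structure $M=(S,R,g)$ has a nonempty set $S$, a serial relation $R$ on $S$, and a valuation $g:S\to2^{\mathcal V}$. A fullpath is an infinite $R$-chain $\sigma=\langle\sigma_0,\sigma_1,\dots\rangle$, with suffixes $\sigma_{\ge i}$ and prefixes $\sigma_{\le i}$. A fullpath is failure-free if $\mathbf v\notin g(\sigma_i)$ for all $i>0$. $ap(w)$ and $sp(w)$ are the sets of all, respectively all failure-free, fullpaths from $w$. $M$ is a RoCTL-structure if $sp(w)\neq\emptyset$ for all $w$. A deviation from $\sigma$ is a fullpath $\pi$ with $\pi_{\le i}=\sigma_{\le i}$ and $\pi_{\ge i+1}$ failure-free for some $i\ge0$. RoCTL*$_{\mathbf v}$ formulas: $\phi::=p\mid\neg\phi\mid\phi\wedge\phi\mid\phi U\phi\mid N\phi\mid A\phi\mid O\phi\mid\blacktriangle\phi$, with $p\in\mathcal V$. They are evaluated on fullpaths: - $N$ and $U$ are the usual next and until; - $A\phi$: $\phi$ holds on all fullpaths from $\sigma_0$; - $O\phi$: $\phi$ holds on all failure-free fullpaths from $\sigma_0$; - $\blacktriangle\phi$: $\phi$ holds on $\sigma$ and on all deviations from $\sigma$. $F\psi=\top U\psi$, $G\psi=\neg F\neg\psi$, $E=\neg A\neg$. A tree structure has a unique root from which all nodes are reachable, unique predecessors for non-root nodes, and no cycles. QCTL* extends CTL* by $\forall p\,\phi$. Its tree semantics evaluates formulas on fullpaths of tree structures, with $\forall p\,\alpha$ true on $\sigma$ iff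 $\alpha$ is true on $\sigma$ in every $p$-variant (valuation changed only on $p$). -}

module Defs where

open import Data.Nat using (ℕ; zero; suc; _+_; _<_; _≤_)
open import Data.Bool using (Bool; true; false)
open import Data.Product using (Σ; ∃; _×_; _,_)
open import Data.List using (List; []; _∷_; _++_)
open import Relation.Nullary using (¬_)
open import Relation.Binary.PropositionalEquality using (_≡_; _≢_)

record Frame : Set₁ where
  field
    S : Set
    R : S → S → Set

open Frame public

record Structure (V : Set) : Set₁ where
  field
    frame    : Frame
    point    : S frame
    serial   : ∀ w → ∃ λ w' → R frame w w'
    val      : S frame → V → Bool            -- p ∈ g(w)  iff  val w p ≡ true

open Structure public

record Fullpath (F : Frame) : Set where
  field
    at   : ℕ → S F
    step : ∀ i → R F (at i) (at (suc i))

open Fullpath public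

suffix : ∀ {F} → Fullpath F → ℕ → Fullpath F
at   (suffix σ i) k = at σ (k + i)
step (suffix σ i) k = step σ (k + i)

module _ {V : Set} (v : V) where

  FailureFree : ∀ {F} → (S F → V → Bool) → Fullpath F → Set
  FailureFree g σ = ∀ i → 0 < i → g (at σ i) v ≡ false

  IsRoCTLStructure : Structure V → Set
  IsRoCTLStructure M =
    ∀ w → ∃ λ (π : Fullpath (frame M)) → (at π 0 ≡ w) × FailureFree (val M) π

  Deviation : ∀ {F} → (S F → V → Bool) → Fullpath F → Fullpath F → Set
  Deviation g σ π = ∃ λ i → (∀ j → j ≤ i → at π j ≡ at σ j)
                          × FailureFree g (suffix π (suc i))

data RForm (V : Set) : Set where
  atom  : V → RForm V
  ¬ᴿ_   : RForm V → RForm V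
  _∧ᴿ_  : RForm V → RForm V → RForm V
  _Uᴿ_  : RForm V → RForm V → RForm V
  Nᴿ    : RForm V → RForm V
  Aᴿ    : RForm V → RForm V
  Oᴿ    : RForm V → RForm V
  ▲ᴿ    : RForm V → RForm V

infix  30 ¬ᴿ_
infixr 25 _∧ᴿ_
infixr 24 _Uᴿ_

module _ {V : Set} (v : V) (M : Structure V) where

  private
    F = frame M
    g = val M

  RSat : Fullpath F → RForm V → Set
  RSat σ (atom p)  = val M (at σ 0) p ≡ true
  RSat σ (¬ᴿ φ)    = ¬ RSat σ φ
  RSat σ (φ ∧ᴿ ψ)  = RSat σ φ × RSat σ ψ
  RSat σ (φ Uᴿ ψ)  = ∃ λ j → RSat (suffix σ j) ψ × (∀ i → i < j → RSat (suffix σ i) φ)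
  RSat σ (Nᴿ φ)    = RSat (suffix σ 1) φ
  RSat σ (Aᴿ φ)    = ∀ (π : Fullpath F) → at π 0 ≡ at σ 0 → RSat π φ
  RSat σ (Oᴿ φ)    = ∀ (π : Fullpath F) → at π 0 ≡ at σ 0 → FailureFree v g π → RSat π φ
  RSat σ (▲ᴿ φ)    = RSat σ φ × (∀ (π : Fullpath F) → Deviation v g σ π → RSat π φ)

RSatisfiable : {V : Set} → V → RForm V → Set₁
RSatisfiable {V} v φ =
  ∃ λ (M : Structure V) → IsRoCTLStructure v M × ∃ λ (σ : Fullpath (frame M)) → RSat v M σ φ

data QForm (V : Set) : Set where
  atom  : V → QForm V
  ¬Q_   : QForm V → QForm V
  _∧Q_  : QForm V → QForm V → QForm V
  _UQ_  : QForm V → QForm V → QForm V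
  NQ    : QForm V → QForm V
  AQ    : QForm V → QForm V
  ∀Q    : V → QForm V → QForm V

infix  30 ¬Q_
infixr 25 _∧Q_
infixr 24 _UQ_

Variant : {V : Set} {S : Set} → V → (S → V → Bool) → (S → V → Bool) → Set
Variant {V} {S} p g g' = ∀ (w : S) (q : V) → q ≢ p → g' w q ≡ g w q

QSat : {V : Set} (F : Frame) → (S F → V → Bool) → Fullpath F → QForm V → Set
QSat F g σ (atom p)  = g (at σ 0) p ≡ true
QSat F g σ (¬Q φ)    = ¬ QSat F g σ φ
QSat F g σ (φ ∧Q ψ)  = QSat F g σ φ × QSat F g σ ψ
QSat F g σ (φ UQ ψ)  = ∃ λ j → QSat F g (suffix σ j) ψ × (∀ i → i < j → QSat F g (suffix σ i) φ)
QSat F g σ (NQ φ)    = QSat F g (suffix σ 1) φ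
QSat F g σ (AQ φ)    = ∀ (π : Fullpath F) → at π 0 ≡ at σ 0 → QSat F g π φ
QSat F g σ (∀Q p φ)  = ∀ g' → Variant p g g' → QSat F g' σ φ

module _ {V : Set} where
  ⊤Q : V → QForm V          -- any atom gives ⊤ := ¬(p ∧ ¬p)
  ⊤Q p = ¬Q (atom p ∧Q ¬Q atom p)

  _∨Q_ : QForm V → QForm V → QForm V
  φ ∨Q ψ = ¬Q (¬Q φ ∧Q ¬Q ψ)

  _⇒Q_ : QForm V → QForm V → QForm V
  φ ⇒Q ψ = ¬Q (φ ∧Q ¬Q ψ)

  FQ : V → QForm V → QForm V
  FQ p ψ = ⊤Q p UQ ψ

  GQ : V → QForm V → QForm V
  GQ p ψ = ¬Q FQ p (¬Q ψ)

  EQ : QForm V → QForm V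
  EQ φ = ¬Q AQ (¬Q φ)

  infixr 22 _∨Q_
  infixr 21 _⇒Q_

  atomsQ : QForm V → List V
  atomsQ (atom p)  = p ∷ []
  atomsQ (¬Q φ)    = atomsQ φ
  atomsQ (φ ∧Q ψ)  = atomsQ φ ++ atomsQ ψ
  atomsQ (φ UQ ψ)  = atomsQ φ ++ atomsQ ψ
  atomsQ (NQ φ)    = atomsQ φ
  atomsQ (AQ φ)    = atomsQ φ
  atomsQ (∀Q p φ)  = p ∷ atomsQ φ

Steps : (F : Frame) → ℕ → S F → S F → Set
Steps F zero    u w = u ≡ w
Steps F (suc n) u w = ∃ λ x → R F u x × Steps F n x w

IsTree : {V : Set} → Structure V → Set
IsTree M =
  let F = frame M in
  ∃ λ (root : S F) →
      (∀ w → ∃ λ n → Steps F n root w)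
    × (∀ w → w ≢ root → (∃ λ u → R F u w)
                       × (∀ u u' → R F u w → R F u' w → u ≡ u'))
    × (∀ w n → ¬ Steps F (suc n) w w)

QTreeSatisfiable : {V : Set} → QForm V → Set₁
QTreeSatisfiable {V} φ =
  ∃ λ (M : Structure V) → IsTree M × ∃ λ (σ : Fullpath (frame M)) → QSat (frame M) (val M) σ φ

module Translation {V : Set} (v : V) (fresh : List V → V) where

  τ : RForm V → QForm V
  τ (atom p) = atom p
  τ (¬ᴿ φ)   = ¬Q τ φ
  τ (φ ∧ᴿ ψ) = τ φ ∧Q τ ψ
  τ (φ Uᴿ ψ) = τ φ UQ τ ψ
  τ (Nᴿ φ)   = NQ (τ φ)
  τ (Aᴿ φ)   = AQ (τ φ)
  τ (Oᴿ φ)   = AQ (NQ (GQ v (¬Q atom v)) ⇒Q τ φ)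
  τ (▲ᴿ φ)   =
    ¬Q ∀Q y (GQ v (atom y) ⇒Q
             EQ ((GQ v (atom y) ∨Q FQ v (atom y ∧Q NQ (NQ (GQ v (¬Q atom v))))) ∧Q ¬Q t))
    where
      t = τ φ
      y = fresh (v ∷ atomsQ t)

  translate : RForm V → QForm V
  translate φ = AQ (GQ v (EQ (NQ (¬Q atom v)))) ∧Q τ φ

-- The proof has three independent ingredients.
--  * Correctness of τ on trees: on any tree structure, σ ⊨ φ iff σ ⊨ τ(φ),
--    by induction on φ.  For ▲φ the fresh atom y is read as "lies on σ":
--    in a tree, a path from σ₀ that meets σ at some state coincides with σ
--    up to that state, so the paths satisfying Gy ∨ F(y ∧ NNG¬v) are exactly
--    σ and its deviations.
--  * Unravelling: the tree unravelling of any structure from a state w₀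
--    (states are finite walks from w₀) is a tree, and its projection onto
--    the original structure preserves and reflects every RoCTL* formula.
--  * AGEN¬v: it holds in every RoCTL-structure, and conversely if it holds
--    on σ then the unravelling from σ₀ is a RoCTL-structure.  Excluded middle, a hypothesis of the theorem, is used for
-- the negations hidden in G, E, → and ∀y, and to define valuations.

module Submission where

open import Defs
open import Level using (0ℓ)
open import Axiom.ExcludedMiddle using (ExcludedMiddle)
open import Axiom.DoubleNegationElimination using (DoubleNegationElimination; em⇒dne)
open import Data.Bool using (Bool; true; false; if_then_else_)
open import Data.Bool.Properties using (¬-not; not-¬)
open import Data.Empty using (⊥-elim)
open import Data.List using (List; _∷_)
open import Data.List.Membership.Propositional using (_∉_; _∈_)
open import Data.List.Membership.Propositional.Properties using (∈-++⁺ˡ; ∈-++⁺ʳ)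
open import Data.List.Relation.Unary.Any using (here; there)
open import Data.Nat using (ℕ; zero; suc; _+_; _∸_; _≤_; z≤n; s≤s)
open import Data.Nat.Properties
  using (+-comm; +-assoc; +-suc; ≤-refl; ≤-total; m≤n⇒m<n∨m≡n; m∸n+n≡m; m≢1+n+m)
open import Data.Product using (Σ; ∃; _×_; _,_; proj₁; proj₂)
open import Data.Product.Function.NonDependent.Propositional using (_×-⇔_)
open import Data.Sum using (inj₁; inj₂)
open import Function.Bundles using (_⇔_; mk⇔; Equivalence)
open import Function.Related.TypeIsomorphisms using (¬-cong-⇔)
open import Relation.Nullary using (¬_; yes; no; does; proof)
open import Relation.Nullary.Reflects using (Reflects; invert)
open import Relation.Nullary.Decidable using (dec-true; dec-false)
open import Relation.Binary.PropositionalEquality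

open Equivalence using (to; from)

module Paths (F : Frame) where

  _≗ₚ_ : Fullpath F → Fullpath F → Set
  σ ≗ₚ π = ∀ k → at σ k ≡ at π k

  -- Needed because RoCTL* negation reverses the direction of transport.
  ≗ₚ-sym : ∀ {σ π} → σ ≗ₚ π → π ≗ₚ σ
  ≗ₚ-sym e k = sym (e k)

  suffix-suffix : ∀ σ i j → suffix (suffix σ i) j ≗ₚ suffix σ (j + i)
  suffix-suffix σ i j k = cong (at σ) (+-assoc k j i)

  cons : (u : S F) (π : Fullpath F) → R F u (at π 0) → Fullpath F
  at (cons u π r) zero = u
  at (cons u π r) (suc k) = at π k
  step (cons u π r) zero = r
  step (cons u π r) (suc k) = step π k

  iterate : (next : S F → S F) → (∀ w → R F w (next w)) → S F → Fullpath F
  at (iterate next r w) zero = w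
  at (iterate next r w) (suc k) = next (at (iterate next r w) k)
  step (iterate next r w) k = r (at (iterate next r w) k)

  mutual
    splice : (s : Fullpath F) (i : ℕ) (π : Fullpath F) → at π 0 ≡ at s i → Fullpath F
    splice s zero π e = cons (at s 0) (suffix π 1) (subst (λ x → R F x (at π 1)) e (step π 0))
    splice s (suc i) π e =
      cons (at s 0) (splice (suffix s 1) i π e′)
           (subst (R F (at s 0)) (sym (splice-start (suffix s 1) i π e′)) (step s 0))
      where e′ = trans e (cong (at s) (+-comm 1 i))

    splice-start : ∀ s i π (e : at π 0 ≡ at s i) → at (splice s i π e) 0 ≡ at s 0
    splice-start s zero π e = refl
    splice-start s (suc i) π e = refl

  splice-prefix : ∀ s i π (e : at π 0 ≡ at s i) →
                  ∀ k → k ≤ i → at (splice s i π e) k ≡ at s k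
  splice-prefix s zero π e zero _ = refl
  splice-prefix s (suc i) π e zero _ = refl
  splice-prefix s (suc i) π e (suc k) (s≤s k≤i) =
    trans (splice-prefix (suffix s 1) i π _ k k≤i) (cong (at s) (+-comm k 1))

  splice-suffix : ∀ s i π (e : at π 0 ≡ at s i) → ∀ k → at (splice s i π e) (i + k) ≡ at π k
  splice-suffix s zero π e zero = sym e
  splice-suffix s zero π e (suc k) = cong (at π) (+-comm k 1)
  splice-suffix s (suc i) π e k = splice-suffix (suffix s 1) i π _ k

module Walks (F : Frame) where

  steps-snoc : ∀ {n a b c} → Steps F n a b → R F b c → Steps F (suc n) a c
  steps-snoc {zero} refl r = _ , r , refl
  steps-snoc {suc n} (x , r′ , s) r = x , r′ , steps-snoc s r

  steps-++ : ∀ {n m a b c} → Steps F n a b → Steps F m b c → Steps F (n + m) a c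
  steps-++ {zero} refl t = t
  steps-++ {suc n} (x , r , s) t = x , r , steps-++ s t

  path-steps : (σ : Fullpath F) (n : ℕ) → Steps F n (at σ 0) (at σ n)
  path-steps σ zero = refl
  path-steps σ (suc n) =
    at σ 1 , step σ 0 ,
    subst (λ m → Steps F n (at σ 1) (at σ m)) (+-comm n 1) (path-steps (suffix σ 1) n)

module Tree {V : Set} (M : Structure V) (tree : IsTree M) where
  private
    F = frame M
    root = proj₁ tree
    reachable = proj₁ (proj₂ tree)
    predecessor = proj₁ (proj₂ (proj₂ tree))
    acyclic = proj₂ (proj₂ (proj₂ tree))
  open Walks F

  no-return : (σ : Fullpath F) (k : ℕ) → at σ (suc k) ≢ at σ 0
  no-return σ k e = acyclic (at σ 0) k (subst (Steps F (suc k) (at σ 0)) e (path-steps σ (suc k)))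

  avoids-root : (σ : Fullpath F) (k : ℕ) → at σ (suc k) ≢ root
  avoids-root σ k e with reachable (at σ 0)
  ... | n , walk = acyclic (at σ 0) (k + n)
                     (steps-++ (subst (Steps F (suc k) (at σ 0)) e (path-steps σ (suc k))) walk)

  -- This is what makes the marking in the translation of ▲ work.
  paths-meet : (π σ : Fullpath F) → at π 0 ≡ at σ 0 → ∀ j k → at π j ≡ at σ k →
               (j ≡ k) × (∀ l → l ≤ j → at π l ≡ at σ l)
  paths-meet π σ e₀ zero zero e = refl , λ { zero z≤n → e₀ }
  paths-meet π σ e₀ zero (suc k) e = ⊥-elim (no-return σ k (trans (sym e) e₀))
  paths-meet π σ e₀ (suc j) zero e = ⊥-elim (no-return π j (trans e (sym e₀)))
  paths-meet π σ e₀ (suc j) (suc k) e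
    with proj₂ (predecessor (at σ (suc k)) (avoids-root σ k))
  ... | unique with paths-meet π σ e₀ j k (unique _ _ (subst (R F (at π j)) e (step π j)) (step σ k))
  ... | refl , prefix = refl , agree
    where
      agree : ∀ l → l ≤ suc j → at π l ≡ at σ l
      agree l l≤ with m≤n⇒m<n∨m≡n l≤
      ... | inj₁ (s≤s l≤j) = prefix l l≤j
      ... | inj₂ refl = e

module Connectives {V : Set} (v : V) {F : Frame} (g : S F → V → Bool) where
  open Paths F

  -- ⊤, F and G are defined connectives; these are their expected meanings
  -- (G-elim needs classical logic, since G is ¬F¬).
  ⊤-holds : ∀ σ → QSat F g σ (⊤Q v)
  ⊤-holds σ (a , ¬a) = ¬a a

  F-intro : ∀ σ ψ j → QSat F g (suffix σ j) ψ → QSat F g σ (FQ v ψ)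
  F-intro σ ψ j h = j , h , λ i _ → ⊤-holds (suffix σ i)

  G-intro : ∀ σ ψ → (∀ j → QSat F g (suffix σ j) ψ) → QSat F g σ (GQ v ψ)
  G-intro σ ψ h (j , ¬ψ , _) = ¬ψ (h j)

  failure-free-≗ₚ : ∀ σ π → σ ≗ₚ π → FailureFree v g σ → FailureFree v g π
  failure-free-≗ₚ σ π e ff i 0<i = subst (λ w → g w v ≡ false) (e i) (ff i 0<i)

  module _ (dne : DoubleNegationElimination 0ℓ) where

    G-elim : ∀ σ ψ → QSat F g σ (GQ v ψ) → ∀ j → QSat F g (suffix σ j) ψ
    G-elim σ ψ h j = dne (λ ¬ψ → h (F-intro σ (¬Q ψ) j ¬ψ))

    NG¬v⇔failure-free : ∀ σ → QSat F g σ (NQ (GQ v (¬Q atom v))) ⇔ FailureFree v g σ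
    NG¬v⇔failure-free σ = mk⇔ to′ from′
      where
        to′ : QSat F g σ (NQ (GQ v (¬Q atom v))) → FailureFree v g σ
        to′ ng (suc k) _ =
          ¬-not (subst (λ n → ¬ g (at σ n) v ≡ true) (+-comm k 1)
                   (G-elim (suffix σ 1) (¬Q atom v) ng k))
        from′ : FailureFree v g σ → QSat F g σ (NQ (GQ v (¬Q atom v)))
        from′ ff = G-intro (suffix σ 1) (¬Q atom v)
          (λ k → not-¬ (subst (λ n → g (at σ n) v ≡ false) (+-comm 1 k) (ff (suc k) (s≤s z≤n))))

    NNG¬v⇔failure-free-after : ∀ σ j →
      QSat F g (suffix σ j) (NQ (NQ (GQ v (¬Q atom v)))) ⇔ FailureFree v g (suffix σ (suc j))
    NNG¬v⇔failure-free-after σ j = mk⇔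
      (λ h → failure-free-≗ₚ σ+j+1 (suffix σ (suc j)) same (to (NG¬v⇔failure-free σ+j+1) h))
      (λ ff → from (NG¬v⇔failure-free σ+j+1)
                (failure-free-≗ₚ (suffix σ (suc j)) σ+j+1
                   (≗ₚ-sym {σ+j+1} {suffix σ (suc j)} same) ff))
      where
        σ+j+1 = suffix (suffix σ j) 1
        same = suffix-suffix σ j 1

module PathInvariance {V : Set} (v : V) (M : Structure V) where
  open Paths (frame M)

  deviation-≗ₚ : ∀ σ σ′ π → σ ≗ₚ σ′ →
                 Deviation v (val M) σ′ π → Deviation v (val M) σ π
  deviation-≗ₚ σ σ′ π e (i , prefix , ff) =
    i , (λ j j≤i → trans (prefix j j≤i) (sym (e j))) , ff

  RSat-≗ₚ : ∀ φ σ σ′ → σ ≗ₚ σ′ → RSat v M σ φ → RSat v M σ′ φ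
  RSat-≗ₚ (atom p) σ σ′ e h = subst (λ w → val M w p ≡ true) (e 0) h
  RSat-≗ₚ (¬ᴿ φ) σ σ′ e h h′ = h (RSat-≗ₚ φ σ′ σ (≗ₚ-sym {σ} {σ′} e) h′)
  RSat-≗ₚ (φ ∧ᴿ ψ) σ σ′ e (a , b) = RSat-≗ₚ φ σ σ′ e a , RSat-≗ₚ ψ σ σ′ e b
  RSat-≗ₚ (φ Uᴿ ψ) σ σ′ e (j , a , b) =
    j , RSat-≗ₚ ψ (suffix σ j) (suffix σ′ j) (λ k → e (k + j)) a ,
    λ i i<j → RSat-≗ₚ φ (suffix σ i) (suffix σ′ i) (λ k → e (k + i)) (b i i<j)
  RSat-≗ₚ (Nᴿ φ) σ σ′ e h = RSat-≗ₚ φ (suffix σ 1) (suffix σ′ 1) (λ k → e (k + 1)) h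
  RSat-≗ₚ (Aᴿ φ) σ σ′ e h π π₀ = h π (trans π₀ (sym (e 0)))
  RSat-≗ₚ (Oᴿ φ) σ σ′ e h π π₀ = h π (trans π₀ (sym (e 0)))
  RSat-≗ₚ (▲ᴿ φ) σ σ′ e (a , b) =
    RSat-≗ₚ φ σ σ′ e a , λ π d → b π (deviation-≗ₚ σ σ′ π e d)

withVal : {V : Set} (M : Structure V) → (S (frame M) → V → Bool) → Structure V
withVal M g = record M { val = g }

module Reinterpret (em : ExcludedMiddle 0ℓ) {V W : Set} where

  _[_≔_] : (W → V → Bool) → V → (W → Set) → W → V → Bool
  (g [ p ≔ P ]) w q = if does (em {q ≡ p}) then does (em {P w}) else g w q

  reinterpret-variant : ∀ g p P → Variant p g (g [ p ≔ P ])
  reinterpret-variant g p P w q q≢p =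
    cong (λ b → if b then does (em {P w}) else g w q) (dec-false (em {q ≡ p}) q≢p)

  reinterpret-at : ∀ g p P w → (g [ p ≔ P ]) w p ≡ does (em {P w})
  reinterpret-at g p P w = cong (λ b → if b then does (em {P w}) else g w p) (dec-true (em {p ≡ p}) refl)

  reinterpret-true : ∀ g p P w → P w → (g [ p ≔ P ]) w p ≡ true
  reinterpret-true g p P w h = trans (reinterpret-at g p P w) (dec-true (em {P w}) h)

  reinterpret-true⁻ : ∀ g p P w → (g [ p ≔ P ]) w p ≡ true → P w
  reinterpret-true⁻ g p P w e =
    invert (subst (Reflects (P w)) (trans (sym (reinterpret-at g p P w)) e) (proof (em {P w})))

module Correctness (em : ExcludedMiddle 0ℓ) {V : Set} (v : V) (fresh : List V → V)
                   (fresh-∉ : ∀ xs → fresh xs ∉ xs) where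
  open Translation v fresh
  open Reinterpret em
  private
    dne = em⇒dne em

  yOf : RForm V → V
  yOf φ = fresh (v ∷ atomsQ (τ φ))

  NNG¬v : QForm V
  NNG¬v = NQ (NQ (GQ v (¬Q atom v)))

  -- When y marks the states of σ: "this is σ itself or a deviation from σ".
  OnOrDeviates : V → QForm V
  OnOrDeviates y = GQ v (atom y) ∨Q FQ v (atom y ∧Q NNG¬v)

  AgreeOn : {W : Set} → List V → (W → V → Bool) → (W → V → Bool) → Set
  AgreeOn As g g′ = (∀ w q → q ∈ As → g w q ≡ g′ w q) × (∀ w → g w v ≡ g′ w v)

  agree-sym : ∀ {W As} {g g′ : W → V → Bool} → AgreeOn As g g′ → AgreeOn As g′ g
  agree-sym (on-As , on-v) = (λ w q q∈ → sym (on-As w q q∈)) , (λ w → sym (on-v w))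

  agree-⊆ : ∀ {W As Bs} {g g′ : W → V → Bool} →
            (∀ {q} → q ∈ As → q ∈ Bs) → AgreeOn Bs g g′ → AgreeOn As g g′
  agree-⊆ As⊆Bs (on-Bs , on-v) = (λ w q q∈ → on-Bs w q (As⊆Bs q∈)) , on-v

  failure-free-agree : ∀ (M : Structure V) (g′ : S (frame M) → V → Bool) (π : Fullpath (frame M)) →
                       (∀ w → val M w v ≡ g′ w v) → FailureFree v g′ π → FailureFree v (val M) π
  failure-free-agree M g′ π on-v ff i 0<i = trans (on-v (at π i)) (ff i 0<i)

  RSat-agree : ∀ φ (M : Structure V) g′ → AgreeOn (atomsQ (τ φ)) (val M) g′ →
               ∀ σ → RSat v M σ φ → RSat v (withVal M g′) σ φ
  RSat-agree (atom p) M g′ (on-As , _) σ h = trans (sym (on-As _ p (here refl))) h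
  RSat-agree (¬ᴿ φ) M g′ agree σ h h′ =
    h (RSat-agree φ (withVal M g′) (val M) (agree-sym agree) σ h′)
  RSat-agree (φ ∧ᴿ ψ) M g′ agree σ (a , b) =
    RSat-agree φ M g′ (agree-⊆ ∈-++⁺ˡ agree) σ a ,
    RSat-agree ψ M g′ (agree-⊆ (∈-++⁺ʳ _) agree) σ b
  RSat-agree (φ Uᴿ ψ) M g′ agree σ (j , a , b) =
    j , RSat-agree ψ M g′ (agree-⊆ (∈-++⁺ʳ _) agree) _ a ,
    λ i i<j → RSat-agree φ M g′ (agree-⊆ ∈-++⁺ˡ agree) _ (b i i<j)
  RSat-agree (Nᴿ φ) M g′ agree σ h = RSat-agree φ M g′ agree _ h
  RSat-agree (Aᴿ φ) M g′ agree σ h π π₀ = RSat-agree φ M g′ agree π (h π π₀)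
  RSat-agree (Oᴿ φ) M g′ agree σ h π π₀ ff =
    RSat-agree φ M g′ (agree-⊆ (∈-++⁺ʳ _) agree) π
      (h π π₀ (failure-free-agree M g′ π (proj₂ agree) ff))
  RSat-agree (▲ᴿ φ) M g′ agree σ (a , b) =
    RSat-agree φ M g′ agree-φ σ a ,
    λ { π (i , prefix , ff) → RSat-agree φ M g′ agree-φ π
          (b π (i , prefix , failure-free-agree M g′ (suffix π (suc i)) (proj₂ agree) ff)) }
    where
      -- the atoms of τ(φ) occur in the ¬E[… ∧ ¬τ(φ)] part of τ(▲φ)
      agree-φ : AgreeOn (atomsQ (τ φ)) (val M) g′
      agree-φ = agree-⊆ (λ q∈ → there (∈-++⁺ʳ (atomsQ (GQ v (atom (yOf φ))))
                                          (∈-++⁺ʳ (atomsQ (OnOrDeviates (yOf φ))) q∈))) agree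

  module Robustly (M : Structure V) (tree : IsTree M) (φ : RForm V)
                  (ih : ∀ g σ → RSat v (withVal M g) σ φ ⇔ QSat (frame M) g σ (τ φ)) where
    private
      F = frame M
      y = yOf φ

      v≢y : v ≢ y
      v≢y e = fresh-∉ _ (here (sym e))

      atoms≢y : ∀ {q} → q ∈ atomsQ (τ φ) → q ≢ y
      atoms≢y q∈ refl = fresh-∉ _ (there q∈)

      variant-agrees : ∀ g′ → Variant y (val M) g′ → AgreeOn (atomsQ (τ φ)) g′ (val M)
      variant-agrees g′ var = (λ w q q∈ → var w q (atoms≢y q∈)) , (λ w → var w v v≢y)

    open Paths F
    open Tree M tree

    -- Soundness: reinterpret y as "lies on σ".  A fullpath from σ₀ satisfying
    -- OnOrDeviates y meets σ, hence agrees with σ up to that point, so it is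
    -- σ itself or a deviation from σ, and satisfies φ.
    ▲-sound : ∀ σ → RSat v M σ (▲ᴿ φ) → QSat F (val M) σ (τ (▲ᴿ φ))
    ▲-sound σ (φ-σ , φ-deviations) ∀y = ∀y g′ variant (y-along-σ , no-counterexample)
      where
        OnPath : S F → Set
        OnPath w = ∃ λ k → at σ k ≡ w
        g′ = val M [ y ≔ OnPath ]
        variant = reinterpret-variant (val M) y OnPath
        agrees = agree-sym (variant-agrees g′ variant)
        open Connectives v g′

        y-along-σ : QSat F g′ σ (GQ v (atom y))
        y-along-σ = G-intro σ (atom y) (λ j → reinterpret-true (val M) y OnPath (at σ j) (j , refl))

        prefix-of-σ : ∀ π → at π 0 ≡ at σ 0 → ∀ j → g′ (at π j) y ≡ true →
                      ∀ l → l ≤ j → at π l ≡ at σ l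
        prefix-of-σ π π₀ j yj with reinterpret-true⁻ (val M) y OnPath (at π j) yj
        ... | k , σk = proj₂ (paths-meet π σ π₀ j k (sym σk))

        covered : ∀ π → at π 0 ≡ at σ 0 → QSat F g′ π (OnOrDeviates y) → RSat v M π φ
        covered π π₀ on-or-deviates with em {QSat F g′ π (GQ v (atom y))}
        ... | yes y-along-π =
          PathInvariance.RSat-≗ₚ v M φ σ π
            (λ k → sym (prefix-of-σ π π₀ k (G-elim dne π (atom y) y-along-π k) k ≤-refl)) φ-σ
        ... | no ¬y-along-π with dne (λ ¬deviates → on-or-deviates (¬y-along-π , ¬deviates))
        ... | j , (yj , nng) , _ =
          φ-deviations π (j , prefix-of-σ π π₀ j yj ,
            failure-free-agree M g′ (suffix π (suc j)) (proj₂ agrees)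
              (to (NNG¬v⇔failure-free-after dne π j) nng))

        no-counterexample : ¬ QSat F g′ σ (EQ (OnOrDeviates y ∧Q ¬Q τ φ))
        no-counterexample ¬∀ = ¬∀ λ π π₀ (on-or-deviates , ¬τ) →
          ¬τ (to (ih g′ π) (RSat-agree φ M g′ agrees π (covered π π₀ on-or-deviates)))

    -- Completeness: take a y-variant refuting the quantified formula; y then
    -- holds along σ and every fullpath from σ₀ satisfying OnOrDeviates y
    -- satisfies τ(φ), which includes σ and its deviations.
    ▲-complete : ∀ σ → QSat F (val M) σ (τ (▲ᴿ φ)) → RSat v M σ (▲ᴿ φ)
    ▲-complete σ ¬∀y = φ-σ , φ-deviations
      where
        Φ = GQ v (atom y) ⇒Q EQ (OnOrDeviates y ∧Q ¬Q τ φ)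

        refuting : Σ (S F → V → Bool) λ g′ → Variant y (val M) g′ × ¬ QSat F g′ σ Φ
        refuting = dne λ ¬∃ → ¬∀y λ g′ var → dne λ ¬Φ → ¬∃ (g′ , var , ¬Φ)

        g′ = proj₁ refuting
        variant = proj₁ (proj₂ refuting)
        open Connectives v g′

        refuted : QSat F g′ σ (GQ v (atom y)) × ¬ QSat F g′ σ (EQ (OnOrDeviates y ∧Q ¬Q τ φ))
        refuted = dne (proj₂ (proj₂ refuting))

        y-along-σ : QSat F g′ σ (GQ v (atom y))
        y-along-σ = proj₁ refuted

        no-counterexample : ∀ π → at π 0 ≡ at σ 0 → ¬ QSat F g′ π (OnOrDeviates y ∧Q ¬Q τ φ)
        no-counterexample = dne (proj₂ refuted)

        τ-on-covered : ∀ π → at π 0 ≡ at σ 0 → QSat F g′ π (OnOrDeviates y) → RSat v M π φ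
        τ-on-covered π π₀ on-or-deviates =
          RSat-agree φ (withVal M g′) (val M) (variant-agrees g′ variant) π
            (from (ih g′ π) (dne λ ¬τ → no-counterexample π π₀ (on-or-deviates , ¬τ)))

        φ-σ : RSat v M σ φ
        φ-σ = τ-on-covered σ refl λ (¬y-along-σ , _) → ¬y-along-σ y-along-σ

        φ-deviations : ∀ π → Deviation v (val M) σ π → RSat v M π φ
        φ-deviations π (i , prefix , ff) = τ-on-covered π (prefix 0 z≤n) λ (_ , ¬deviates) →
          ¬deviates (F-intro π (atom y ∧Q NNG¬v) i (y-at-i , nng))
          where
            y-at-i : g′ (at π i) y ≡ true
            y-at-i = subst (λ w → g′ w y ≡ true) (sym (prefix i ≤-refl))
                       (G-elim dne σ (atom y) y-along-σ i)
            nng : QSat F g′ (suffix π i) NNG¬v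
            nng = from (NNG¬v⇔failure-free-after dne π i)
                    (failure-free-agree (withVal M g′) (val M) (suffix π (suc i))
                      (proj₂ (variant-agrees g′ variant)) ff)

  τ-correct : ∀ φ (M : Structure V) → IsTree M →
              ∀ σ → RSat v M σ φ ⇔ QSat (frame M) (val M) σ (τ φ)
  τ-correct (atom p) M tree σ = mk⇔ (λ h → h) (λ h → h)
  τ-correct (¬ᴿ φ) M tree σ = ¬-cong-⇔ (τ-correct φ M tree σ)
  τ-correct (φ ∧ᴿ ψ) M tree σ = τ-correct φ M tree σ ×-⇔ τ-correct ψ M tree σ
  τ-correct (φ Uᴿ ψ) M tree σ =
    mk⇔ (λ (j , a , b) → j , to (ih-ψ _) a , λ i i<j → to (ih-φ _) (b i i<j))
        (λ (j , a , b) → j , from (ih-ψ _) a , λ i i<j → from (ih-φ _) (b i i<j))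
    where
      ih-φ = τ-correct φ M tree
      ih-ψ = τ-correct ψ M tree
  τ-correct (Nᴿ φ) M tree σ = τ-correct φ M tree (suffix σ 1)
  τ-correct (Aᴿ φ) M tree σ =
    mk⇔ (λ h π π₀ → to (τ-correct φ M tree π) (h π π₀))
        (λ h π π₀ → from (τ-correct φ M tree π) (h π π₀))
  τ-correct (Oᴿ φ) M tree σ =
    mk⇔ (λ h π π₀ (ng , ¬τφ) → ¬τφ (to (ih π) (h π π₀ (to (ng⇔ff π) ng))))
        (λ h π π₀ ff → from (ih π) (dne λ ¬τφ → h π π₀ (from (ng⇔ff π) ff , ¬τφ)))
    where
      ih = τ-correct φ M tree
      ng⇔ff = Connectives.NG¬v⇔failure-free v (val M) dne
  τ-correct (▲ᴿ φ) M tree σ = mk⇔ (▲-sound σ) (▲-complete σ)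
    where open Robustly M tree φ (λ g → τ-correct φ (withVal M g) tree)

module Unravel {V : Set} (v : V) (M : Structure V) (w₀ : S (frame M)) where
  private
    F = frame M

  data Walk : S F → Set where
    start : Walk w₀
    _▸_   : ∀ {u w} → Walk u → R F u w → Walk w

  UState : Set
  UState = Σ (S F) Walk

  data Extends : UState → UState → Set where
    extend : ∀ {u w} (p : Walk u) (r : R F u w) → Extends (u , p) (w , p ▸ r)

  UF : Frame
  UF = record { S = UState ; R = Extends }

  unravelled : Structure V
  unravelled = record
    { frame  = UF
    ; point  = w₀ , start
    ; serial = λ (w , p) → let (w′ , r) = serial M w in (w′ , p ▸ r) , extend p r
    ; val    = λ s → val M (proj₁ s)
    }

  open Paths

  underlying : ∀ {s s′} → Extends s s′ → R F (proj₁ s) (proj₁ s′)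
  underlying (extend p r) = r

  down : Fullpath UF → Fullpath F
  at (down ρ) k = proj₁ (at ρ k)
  step (down ρ) k = underlying (step ρ k)

  walk-along : (π : Fullpath F) → Walk (at π 0) → ∀ k → Walk (at π k)
  walk-along π p zero = p
  walk-along π p (suc k) = walk-along π p k ▸ step π k

  up : (π : Fullpath F) → Walk (at π 0) → Fullpath UF
  at (up π p) k = at π k , walk-along π p k
  step (up π p) k = extend (walk-along π p k) (step π k)

  up-from : (s : UState) (π : Fullpath F) → at π 0 ≡ proj₁ s → Fullpath UF
  up-from (w , p) π e = up π (subst Walk (sym e) p)

  up-from-start : ∀ s π (e : at π 0 ≡ proj₁ s) → at (up-from s π e) 0 ≡ s
  up-from-start (w , p) π refl = refl

  -- A deviation in M from the projection of ρ lifts to a deviation from ρ: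
  -- follow ρ up to the branching point, then lift the rest of the deviation.
  lift-deviation : ∀ ρ π → Deviation v (val M) (down ρ) π →
                   ∃ λ ρ′ → Deviation v (val unravelled) ρ ρ′ × _≗ₚ_ F (down ρ′) π
  lift-deviation ρ π (i , prefix , ff) =
    ρ′ , (i , splice-prefix UF ρ i tail tail₀ , ff′) , down-ρ′
    where
      tail = up-from (at ρ i) (suffix π i) (prefix i ≤-refl)
      tail₀ = up-from-start (at ρ i) (suffix π i) (prefix i ≤-refl)
      ρ′ = splice UF ρ i tail tail₀

      down-ρ′ : _≗ₚ_ F (down ρ′) π
      down-ρ′ k with ≤-total k i
      ... | inj₁ k≤i =
        trans (cong proj₁ (splice-prefix UF ρ i tail tail₀ k k≤i)) (sym (prefix k k≤i))
      ... | inj₂ i≤k = begin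
        proj₁ (at ρ′ k)               ≡⟨ cong (λ n → proj₁ (at ρ′ n)) (sym i+[k∸i]≡k) ⟩
        proj₁ (at ρ′ (i + (k ∸ i)))   ≡⟨ cong proj₁ (splice-suffix UF ρ i tail tail₀ (k ∸ i)) ⟩
        proj₁ (at tail (k ∸ i))       ≡⟨⟩
        at π (k ∸ i + i)              ≡⟨ cong (at π) (m∸n+n≡m i≤k) ⟩
        at π k                        ∎
        where
          open ≡-Reasoning
          i+[k∸i]≡k : i + (k ∸ i) ≡ k
          i+[k∸i]≡k = trans (+-comm i (k ∸ i)) (m∸n+n≡m i≤k)

      ff′ : FailureFree v (val unravelled) (suffix ρ′ (suc i))
      ff′ j 0<j = subst (λ w → val M w v ≡ false) (sym (down-ρ′ (j + suc i))) (ff j 0<j)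

  unravel-preserves : ∀ φ ρ → RSat v M (down ρ) φ ⇔ RSat v unravelled ρ φ
  unravel-preserves (atom p) ρ = mk⇔ (λ h → h) (λ h → h)
  unravel-preserves (¬ᴿ φ) ρ = ¬-cong-⇔ (unravel-preserves φ ρ)
  unravel-preserves (φ ∧ᴿ ψ) ρ = unravel-preserves φ ρ ×-⇔ unravel-preserves ψ ρ
  unravel-preserves (φ Uᴿ ψ) ρ =
    mk⇔ (λ (j , a , b) → j , to (ih-ψ _) a , λ i i<j → to (ih-φ _) (b i i<j))
        (λ (j , a , b) → j , from (ih-ψ _) a , λ i i<j → from (ih-φ _) (b i i<j))
    where
      ih-φ = unravel-preserves φ
      ih-ψ = unravel-preserves ψ
  unravel-preserves (Nᴿ φ) ρ = unravel-preserves φ (suffix ρ 1)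
  unravel-preserves (Aᴿ φ) ρ =
    mk⇔ (λ h ρ′ ρ′₀ → to (unravel-preserves φ ρ′) (h (down ρ′) (cong proj₁ ρ′₀)))
        (λ h π π₀ → from (unravel-preserves φ (up-from (at ρ 0) π π₀))
                      (h (up-from (at ρ 0) π π₀) (up-from-start (at ρ 0) π π₀)))
  unravel-preserves (Oᴿ φ) ρ =
    mk⇔ (λ h ρ′ ρ′₀ ff → to (unravel-preserves φ ρ′) (h (down ρ′) (cong proj₁ ρ′₀) ff))
        (λ h π π₀ ff → from (unravel-preserves φ (up-from (at ρ 0) π π₀))
                         (h (up-from (at ρ 0) π π₀) (up-from-start (at ρ 0) π π₀) ff))
  unravel-preserves (▲ᴿ φ) ρ =
    mk⇔ (λ (φ-ρ , φ-deviations) →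
           to (unravel-preserves φ ρ) φ-ρ ,
           λ ρ′ (i , prefix , ff) → to (unravel-preserves φ ρ′)
             (φ-deviations (down ρ′) (i , (λ j j≤i → cong proj₁ (prefix j j≤i)) , ff)))
        (λ (φ-ρ , φ-deviations) →
           from (unravel-preserves φ ρ) φ-ρ ,
           λ π deviation → let (ρ′ , deviation′ , down-ρ′) = lift-deviation ρ π deviation in
             PathInvariance.RSat-≗ₚ v M φ (down ρ′) π down-ρ′
               (from (unravel-preserves φ ρ′) (φ-deviations ρ′ deviation′)))

  -- The unravelling is a tree: the depth of a walk is its length, which
  -- every transition increases by one.
  open Walks UF

  length : ∀ {w} → Walk w → ℕ
  length start = 0
  length (p ▸ r) = suc (length p)

  length-steps : ∀ {n s s′} → Steps UF n s s′ → length (proj₂ s′) ≡ n + length (proj₂ s)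
  length-steps {zero} refl = refl
  length-steps {suc n} (_ , extend p r , walk) = trans (length-steps walk) (+-suc n (length p))

  reach-walk : ∀ {w} (p : Walk w) → ∃ λ n → Steps UF n (w₀ , start) (w , p)
  reach-walk start = 0 , refl
  reach-walk (p ▸ r) = let (n , walk) = reach-walk p in suc n , steps-snoc walk (extend p r)

  unique-predecessor : ∀ {u w} (p : Walk u) (r : R F u w) s s′ →
                       Extends s (w , p ▸ r) → Extends s′ (w , p ▸ r) → s ≡ s′
  unique-predecessor p r _ _ (extend .p .r) (extend .p .r) = refl

  predecessor : ∀ s → s ≢ (w₀ , start) →
                (∃ λ s′ → Extends s′ s) × (∀ s′ s″ → Extends s′ s → Extends s″ s → s′ ≡ s″)
  predecessor (w , start) s≢root = ⊥-elim (s≢root refl)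
  predecessor (w , p ▸ r) _ = (_ , extend p r) , unique-predecessor p r

  unravelled-tree : IsTree unravelled
  unravelled-tree =
    (w₀ , start) ,
    (λ (w , p) → reach-walk p) ,
    predecessor ,
    (λ s n cycle → m≢1+n+m (length (proj₂ s)) (length-steps cycle))

-- The conjunct AGEN¬v: along every fullpath every state has a successor
-- that is not a failure.  It characterises RoCTL-structures up to unravelling.
module NonFailingSuccessors {V : Set} (v : V) where

  AGEN¬v : QForm V
  AGEN¬v = AQ (GQ v (EQ (NQ (¬Q atom v))))

  CanSucceed : (M : Structure V) → S (frame M) → Set
  CanSucceed M w = ∃ λ w′ → R (frame M) w w′ × val M w′ v ≡ false

  -- Choosing such a successor everywhere yields failure-free fullpaths.
  can-succeed⇒roctl : ∀ M → (∀ w → CanSucceed M w) → IsRoCTLStructure v M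
  can-succeed⇒roctl M succeed w = path , refl , failure-free
    where
      path = Paths.iterate (frame M) (λ u → proj₁ (succeed u)) (λ u → proj₁ (proj₂ (succeed u))) w
      failure-free : FailureFree v (val M) path
      failure-free (suc k) _ = proj₂ (proj₂ (succeed (at path k)))

  roctl⇒can-succeed : ∀ M → IsRoCTLStructure v M → ∀ w → CanSucceed M w
  roctl⇒can-succeed M roctl w =
    let (π , π₀ , ff) = roctl w in
    at π 1 , subst (λ u → R (frame M) u (at π 1)) π₀ (step π 0) , ff 1 (s≤s z≤n)

  roctl⇒AGEN¬v : ∀ M → IsRoCTLStructure v M → ∀ σ → QSat (frame M) (val M) σ AGEN¬v
  roctl⇒AGEN¬v M roctl σ π π₀ =
    Connectives.G-intro v {frame M} (val M) π (EQ (NQ (¬Q atom v))) λ j ¬E →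
    let (π′ , π′₀ , ff) = roctl (at π j) in ¬E π′ π′₀ (not-¬ (ff 1 (s≤s z≤n)))

  unravel-roctl : ∀ M w₀ → IsRoCTLStructure v M → IsRoCTLStructure v (Unravel.unravelled v M w₀)
  unravel-roctl M w₀ roctl = can-succeed⇒roctl unravelled λ (w , p) →
    let (w′ , r , ok) = roctl⇒can-succeed M roctl w in (w′ , p ▸ r) , extend p r , ok
    where open Unravel v M w₀

  -- Conversely, if AGEN¬v holds on σ then the unravelling from σ₀ is a
  -- RoCTL-structure: every state reachable from σ₀ lies on a fullpath from σ₀.
  module _ (em : ExcludedMiddle 0ℓ) (M : Structure V) (σ : Fullpath (frame M))
           (agen : QSat (frame M) (val M) σ AGEN¬v) where
    private
      F = frame M
      dne = em⇒dne em
    open Unravel v M (at σ 0)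
    open Connectives v {F} (val M)

    AlwaysCanSucceed : S F → Set
    AlwaysCanSucceed w = ∀ (π : Fullpath F) → at π 0 ≡ w → ∀ j → CanSucceed M (at π j)

    always-from-σ₀ : AlwaysCanSucceed (at σ 0)
    always-from-σ₀ π π₀ j = dne λ ¬succeed →
      G-elim dne π (EQ (NQ (¬Q atom v))) (agen π π₀) j λ π′ π′₀ ¬failure →
        ¬succeed (at π′ 1 , subst (λ u → R F u (at π′ 1)) π′₀ (step π′ 0) , ¬-not ¬failure)

    always-step : ∀ {u w} → AlwaysCanSucceed u → R F u w → AlwaysCanSucceed w
    always-step {u} always r π π₀ j =
      always (Paths.cons F u π (subst (R F u) (sym π₀) r)) refl (suc j)

    always-along-walks : ∀ {w} → Walk w → AlwaysCanSucceed w
    always-along-walks start = always-from-σ₀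
    always-along-walks (p ▸ r) = always-step (always-along-walks p) r

    AGEN¬v⇒unravel-roctl : IsRoCTLStructure v unravelled
    AGEN¬v⇒unravel-roctl = can-succeed⇒roctl unravelled λ (w , p) →
      let (w′ , r , ok) = always-along-walks p (some-path w) refl 0 in (w′ , p ▸ r) , extend p r , ok
      where
        some-path : S F → Fullpath F
        some-path = Paths.iterate F (λ u → proj₁ (serial M u)) (λ u → proj₂ (serial M u))

-- Both directions unravel the given model from the first state of its
-- fullpath σ and lift σ to the unravelling.
mainTheorem9 : ExcludedMiddle 0ℓ →
    {V : Set} (v : V) (fresh : List V → V) → (∀ xs → fresh xs ∉ xs) →
    (φ : RForm V) →
    (RSatisfiable v φ → QTreeSatisfiable (Translation.translate v fresh φ))
    × (QTreeSatisfiable (Translation.translate v fresh φ) → RSatisfiable v φ)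
mainTheorem9 em v fresh fresh-∉ φ = sound , complete
  where
    open Translation v fresh
    open Correctness em v fresh fresh-∉
    open NonFailingSuccessors v

    -- The unravelling of a RoCTL-structure is a RoCTL tree, so it satisfies
    -- AGEN¬v, and τ(φ) holds on the lifted fullpath by correctness on trees.
    sound : RSatisfiable v φ → QTreeSatisfiable (translate φ)
    sound (M , roctl , σ , φ-σ) =
      unravelled , unravelled-tree , σ̂ ,
      roctl⇒AGEN¬v unravelled (unravel-roctl M (at σ 0) roctl) σ̂ ,
      to (τ-correct φ unravelled unravelled-tree σ̂) (to (unravel-preserves φ σ̂) φ-σ)
      where
        open Unravel v M (at σ 0)
        σ̂ = up σ start

    -- On the tree model φ holds by correctness of τ; AGEN¬v makes the
    -- unravelling a RoCTL-structure, and the lifted fullpath still satisfies φ.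
    complete : QTreeSatisfiable (translate φ) → RSatisfiable v φ
    complete (M , tree , σ , agen , τφ-σ) =
      unravelled , AGEN¬v⇒unravel-roctl em M σ agen , σ̂ ,
      to (unravel-preserves φ σ̂) (from (τ-correct φ M tree σ) τφ-σ)
      where
        open Unravel v M (at σ 0)
        σ̂ = up σ start
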